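{- Let $e$ be a relational algebra expression, $\mathcal{T}$ a type assignment on ${\it Relvars}(e)$ and $\tau$ a type such that $\mathcal{T}\vdash e:\tau$. Let $\mathcal{A}$ be a set of attribute names with $\mathcal{A}\supseteq{\it Specattrs}(e)$. Then $\mathcal{T}|_{\mathcal{A}}\vdash e:\tau\cap\mathcal{A}$, where $\mathcal{T}|_{\mathcal{A}}$ is the type assignment with $\mathcal{T}|_{\mathcal{A}}(r)=\mathcal{T}(r)\cap\mathcal{A}$.
   Context: A type is a finite set of attribute names; a type assignment on a finite set $S$ of relation variables maps each $r\in S$ to a type. Relational algebra expressions are generated by $e \to r \mid (e\cup e)\mid (e-e)\mid (e\Join e)\mid (e\times e)\mid \sigma_{\theta(A_1,\ldots,A_n)}(e)\mid \pi_{A_1,\ldots,A_n}(e)\mid \rho_{A/B}(e)\mid \widehat{\pi}_A(e)$, with $r$ a relation variable, $A,B,A_i$ attribute names, $\theta$ a selection predicate. ${\it Relvars}(e)$ is the set of relation variables occurring in $e$; ${\it Specattrs}(e)$ is the set of attribute names explicitly occurring in $e$ (the $A_i$ in $\sigma$ and $\pi$, $A$ and $B$ in $\rho_{A/B}$, $A$ in $\widehat\pi_A$). The judgment $\mathcal{T}\vdash e:\tau$ is defined inductively: $\mathcal{T}\vdash r:\mathcal{T}(r)$; if $\mathcal{T}\vdash e_1:\tau$ and $\mathcal{T}\vdash e_2:\tau$ then $\mathcal{T}\vdash (e_1\cup e_2):\tau$ and $\mathcal{T}\vdash(e_1-e_2):\tau$; if $\mathcal{T}\vdash e_1:\tau_1$,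 $\mathcal{T}\vdash e_2:\tau_2$ then $\mathcal{T}\vdash (e_1\Join e_2):\tau_1\cup\tau_2$, and if moreover $\tau_1\cap\tau_2=\emptyset$ then $\mathcal{T}\vdash(e_1\times e_2):\tau_1\cup\tau_2$; if $\mathcal{T}\vdash e:\tau$ and $A_1,\ldots,A_n\in\tau$ then $\mathcal{T}\vdash \sigma_{\theta(A_1,\ldots,A_n)}(e):\tau$ and $\mathcal{T}\vdash\pi_{A_1,\ldots,A_n}(e):\{A_1,\ldots,A_n\}$; if $\mathcal{T}\vdash e:\tau$, $A\in\tau$, $B\notin\tau$ then $\mathcal{T}\vdash\rho_{A/B}(e):(\tau-\{A\})\cup\{B\}$; if $\mathcal{T}\vdash e:\tau$ and $A\in\tau$ then $\mathcal{T}\vdash\widehat{\pi}_A(e):\tau-\{A\}$. -}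

module Defs where

open import Level using (0ℓ)
open import Data.List using (List)
open import Data.List.Membership.Propositional using (_∈_)
open import Data.Product using (_×_)
open import Relation.Unary using (Pred; _∩_; _∪_; _∖_; _≐_; _⊆_; ∅; Empty) renaming (_∉_ to _∉ₚ_; _∈_ to _∈ₚ_)
open import Relation.Binary.PropositionalEquality using (_≡_; _≢_)

AType : Set → Set₁
AType Attr = Pred Attr 0ℓ

⟦_⟧ : {Attr : Set} → Attr → AType Attr
⟦ a ⟧ = λ x → x ≡ a

fromList : {Attr : Set} → List Attr → AType Attr
fromList as = λ x → x ∈ as

data Expr (R Attr Θ : Set) : Set where
  var   : R → Expr R Attr Θ
  _∪ₑ_  : Expr R Attr Θ → Expr R Attr Θ → Expr R Attr Θ
  _−ₑ_  : Expr R Attr Θ → Expr R Attr Θ → Expr R Attr Θ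
  _⋈_   : Expr R Attr Θ → Expr R Attr Θ → Expr R Attr Θ
  _×ₑ_  : Expr R Attr Θ → Expr R Attr Θ → Expr R Attr Θ
  σ     : Θ → List Attr → Expr R Attr Θ → Expr R Attr Θ
  π     : List Attr → Expr R Attr Θ → Expr R Attr Θ
  ρ     : Attr → Attr → Expr R Attr Θ → Expr R Attr Θ   -- ρ A B e = ρ_{A/B}(e)
  π̂     : Attr → Expr R Attr Θ → Expr R Attr Θ

module _ {R Attr Θ : Set} where

  Specattrs : Expr R Attr Θ → AType Attr
  Specattrs (var r)     = ∅
  Specattrs (e ∪ₑ e')   = Specattrs e ∪ Specattrs e'
  Specattrs (e −ₑ e')   = Specattrs e ∪ Specattrs e'
  Specattrs (e ⋈ e')    = Specattrs e ∪ Specattrs e'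
  Specattrs (e ×ₑ e')   = Specattrs e ∪ Specattrs e'
  Specattrs (σ θ as e)  = fromList as ∪ Specattrs e
  Specattrs (π as e)    = fromList as ∪ Specattrs e
  Specattrs (ρ a b e)   = (⟦ a ⟧ ∪ ⟦ b ⟧) ∪ Specattrs e
  Specattrs (π̂ a e)     = ⟦ a ⟧ ∪ Specattrs e

  -- Typing judgment T ⊢ e ∶ τ. Types are sets, compared extensionally (≐),
  -- hence the conversion rule.
  data _⊢_∶_ (T : R → AType Attr) : Expr R Attr Θ → AType Attr → Set₁ where
    conv  : ∀ {e τ τ'} → T ⊢ e ∶ τ → τ ≐ τ' → T ⊢ e ∶ τ'
    t-var : ∀ {r} → T ⊢ var r ∶ T r
    t-∪   : ∀ {e₁ e₂ τ} → T ⊢ e₁ ∶ τ → T ⊢ e₂ ∶ τ → T ⊢ (e₁ ∪ₑ e₂) ∶ τ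
    t-−   : ∀ {e₁ e₂ τ} → T ⊢ e₁ ∶ τ → T ⊢ e₂ ∶ τ → T ⊢ (e₁ −ₑ e₂) ∶ τ
    t-⋈   : ∀ {e₁ e₂ τ₁ τ₂} → T ⊢ e₁ ∶ τ₁ → T ⊢ e₂ ∶ τ₂ → T ⊢ (e₁ ⋈ e₂) ∶ (τ₁ ∪ τ₂)
    t-×   : ∀ {e₁ e₂ τ₁ τ₂} → T ⊢ e₁ ∶ τ₁ → T ⊢ e₂ ∶ τ₂ → Empty (τ₁ ∩ τ₂)
          → T ⊢ (e₁ ×ₑ e₂) ∶ (τ₁ ∪ τ₂)
    t-σ   : ∀ {θ as e τ} → T ⊢ e ∶ τ → fromList as ⊆ τ → T ⊢ σ θ as e ∶ τ
    t-π   : ∀ {as e τ} → T ⊢ e ∶ τ → fromList as ⊆ τ → T ⊢ π as e ∶ fromList as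
    t-ρ   : ∀ {a b e τ} → T ⊢ e ∶ τ → a ∈ₚ τ → b ∉ₚ τ
          → T ⊢ ρ a b e ∶ ((τ ∖ ⟦ a ⟧) ∪ ⟦ b ⟧)
    t-π̂   : ∀ {a e τ} → T ⊢ e ∶ τ → a ∈ₚ τ → T ⊢ π̂ a e ∶ (τ ∖ ⟦ a ⟧)

_∣ₐ_ : {R Attr : Set} → (R → AType Attr) → AType Attr → (R → AType Attr)
(T ∣ₐ 𝒜) r = T r ∩ 𝒜

-- Induction on the typing derivation: every rule commutes with intersecting
-- all types with 𝒜. The only side conditions that need 𝒜 are the attribute
-- names the rule mentions (the projected list, a and b of ρ, a of π̂), and
-- those lie in Specattrs e ⊆ 𝒜.
module Submission where

open import Defs
open import Level using (Level)
open import Data.Product using (_,_; proj₁)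
open import Data.Sum using (inj₁; inj₂)
open import Function using (_∘_)
open import Relation.Binary.PropositionalEquality using (refl)
open import Relation.Unary using (Pred; _∈_; _∩_; _∪_; _∖_; _≐_; _⊆_)
open import Relation.Unary.Properties using (≐-sym; ≐-trans)

module _ {A : Set} {ℓ : Level} where

  ∩-congʳ : {P Q : Pred A ℓ} (X : Pred A ℓ) → P ≐ Q → P ∩ X ≐ Q ∩ X
  ∩-congʳ X (P⊆Q , Q⊆P) = (λ (p , x) → P⊆Q p , x) , (λ (q , x) → Q⊆P q , x)

  ∪-congʳ : {P Q : Pred A ℓ} (X : Pred A ℓ) → P ≐ Q → P ∪ X ≐ Q ∪ X
  ∪-congʳ X (P⊆Q , Q⊆P) = (λ { (inj₁ p) → inj₁ (P⊆Q p) ; (inj₂ x) → inj₂ x })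
                        , (λ { (inj₁ q) → inj₁ (Q⊆P q) ; (inj₂ x) → inj₂ x })

  ∩-distribʳ-∪ : (P Q X : Pred A ℓ) → (P ∪ Q) ∩ X ≐ (P ∩ X) ∪ (Q ∩ X)
  ∩-distribʳ-∪ P Q X = (λ { (inj₁ p , x) → inj₁ (p , x) ; (inj₂ q , x) → inj₂ (q , x) })
                     , (λ { (inj₁ (p , x)) → inj₁ p , x ; (inj₂ (q , x)) → inj₂ q , x })

  ∩-∖-comm : (P X Y : Pred A ℓ) → (P ∩ X) ∖ Y ≐ (P ∖ Y) ∩ X
  ∩-∖-comm P X Y = (λ ((p , x) , ¬y) → (p , ¬y) , x) , (λ ((p , ¬y) , x) → (p , x) , ¬y)

  ⊆⇒∩-identityʳ : {P X : Pred A ℓ} → P ⊆ X → P ∩ X ≐ P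
  ⊆⇒∩-identityʳ P⊆X = proj₁ , (λ p → p , P⊆X p)

  modular : {S X : Pred A ℓ} (Q : Pred A ℓ) → S ⊆ X → (Q ∩ X) ∪ S ≐ (Q ∪ S) ∩ X
  modular Q S⊆X = (λ { (inj₁ (q , x)) → inj₁ q , x ; (inj₂ s) → inj₂ s , S⊆X s })
                , (λ { (inj₁ q , x) → inj₁ (q , x) ; (inj₂ s , _) → inj₂ s })

⟦⟧-⊆ : {Attr : Set} {a : Attr} {P : AType Attr} → a ∈ P → ⟦ a ⟧ ⊆ P
⟦⟧-⊆ a∈P refl = a∈P

module _ {R Attr Θ : Set} (T : R → AType Attr) (𝒜 : AType Attr) where

  ⊢-restrict : {e : Expr R Attr Θ} {τ : AType Attr}
    → T ⊢ e ∶ τ → Specattrs e ⊆ 𝒜 → (T ∣ₐ 𝒜) ⊢ e ∶ (τ ∩ 𝒜)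
  ⊢-restrict (conv d τ≐τ') s = conv (⊢-restrict d s) (∩-congʳ 𝒜 τ≐τ')
  ⊢-restrict t-var s = t-var
  ⊢-restrict (t-∪ d₁ d₂) s = t-∪ (⊢-restrict d₁ (s ∘ inj₁)) (⊢-restrict d₂ (s ∘ inj₂))
  ⊢-restrict (t-− d₁ d₂) s = t-− (⊢-restrict d₁ (s ∘ inj₁)) (⊢-restrict d₂ (s ∘ inj₂))
  ⊢-restrict (t-⋈ {τ₁ = τ₁} {τ₂} d₁ d₂) s =
    conv (t-⋈ (⊢-restrict d₁ (s ∘ inj₁)) (⊢-restrict d₂ (s ∘ inj₂))) (≐-sym (∩-distribʳ-∪ τ₁ τ₂ 𝒜))
  ⊢-restrict (t-× {τ₁ = τ₁} {τ₂} d₁ d₂ disjoint) s =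
    conv (t-× (⊢-restrict d₁ (s ∘ inj₁)) (⊢-restrict d₂ (s ∘ inj₂))
              (λ x ((p , _) , (q , _)) → disjoint x (p , q)))
         (≐-sym (∩-distribʳ-∪ τ₁ τ₂ 𝒜))
  ⊢-restrict (t-σ d as⊆τ) s = t-σ (⊢-restrict d (s ∘ inj₂)) (λ p → as⊆τ p , s (inj₁ p))
  ⊢-restrict (t-π d as⊆τ) s =
    conv (t-π (⊢-restrict d (s ∘ inj₂)) (λ p → as⊆τ p , s (inj₁ p)))
         (≐-sym (⊆⇒∩-identityʳ (s ∘ inj₁)))
  ⊢-restrict (t-ρ {a} {b} {τ = τ} d a∈τ b∉τ) s =
    conv (t-ρ (⊢-restrict d (s ∘ inj₂)) (a∈τ , s (inj₁ (inj₁ refl))) (λ (b∈τ , _) → b∉τ b∈τ))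
         (≐-trans (∪-congʳ ⟦ b ⟧ (∩-∖-comm τ 𝒜 ⟦ a ⟧))
                  (modular (τ ∖ ⟦ a ⟧) (⟦⟧-⊆ (s (inj₁ (inj₂ refl))))))
  ⊢-restrict (t-π̂ {a} {τ = τ} d a∈τ) s =
    conv (t-π̂ (⊢-restrict d (s ∘ inj₂)) (a∈τ , s (inj₁ refl))) (∩-∖-comm τ 𝒜 ⟦ a ⟧)

lemma1 : {R Attr Θ : Set} (e : Expr R Attr Θ) (T : R → AType Attr) (τ : AType Attr)
    → T ⊢ e ∶ τ → (𝒜 : AType Attr) → Specattrs e ⊆ 𝒜
    → (T ∣ₐ 𝒜) ⊢ e ∶ (τ ∩ 𝒜)
lemma1 e T τ d 𝒜 s = ⊢-restrict T 𝒜 d s
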